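{- Every diamond of flowers is line $[B,A]$-nice.
   Context: For $n\in\mathbb N$, a diamond of $n$ flowers has vertices $v,u_1,u_2,w,x_1,\dots,x_n$ and edges $vu_1,vu_2,u_1u_2,wu_1,wu_2$ and $vx_j$ ($1\le j\le n$). In the $[B,A]$-edge colouring game with $k$ colours, Bob and Alice alternately colour a previously uncoloured edge with one of $k$ colours so that edges sharing an endpoint get distinct colours; Bob moves first; Alice (only) may skip any of her moves. The game ends when no move is possible; Alice wins iff all edges are coloured. A graph $G$ is line $[B,A]$-nice if the least $k$ for which Alice has a winning strategy equals $\omega(L(G))$, the maximum number of pairwise adjacent edges of $G$. -}

module Defs where

open import Data.Nat using (ℕ; zero; suc; _+_; _≤_; _<_)
open import Data.Fin using (Fin; zero; suc)
open import Data.Maybe using (Maybe; just; nothing)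
open import Data.Product using (Σ; _×_; _,_; proj₁; proj₂; ∃-syntax)
open import Data.Sum using (_⊎_)
open import Data.List using (List; length)
open import Data.List.Membership.Propositional using (_∈_)
open import Data.List.Relation.Unary.Unique.Propositional using (Unique)
open import Relation.Binary.PropositionalEquality using (_≡_; _≢_)
open import Relation.Nullary using (¬_)

record Graph : Set where
  field
    V    : ℕ
    E    : ℕ
    ends : Fin E → Fin V × Fin V
open Graph public

_incident_ : (G : Graph) → Fin (E G) → Fin (V G) → Set
(G incident e) x = (proj₁ (ends G e) ≡ x) ⊎ (proj₂ (ends G e) ≡ x)

Adjacent : (G : Graph) → Fin (E G) → Fin (E G) → Set
Adjacent G e f = (e ≢ f) × (∃[ x ] ((G incident e) x × (G incident f) x))

IsEdgeClique : (G : Graph) → List (Fin (E G)) → Set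
IsEdgeClique G S =
  Unique S × (∀ {e f} → e ∈ S → f ∈ S → e ≢ f → Adjacent G e f)

IsOmegaL : Graph → ℕ → Set
IsOmegaL G ω =
  (∃[ S ] (IsEdgeClique G S × length S ≡ ω)) ×
  (∀ S → IsEdgeClique G S → length S ≤ ω)

-- a partial colouring: nothing = uncoloured
Position : Graph → ℕ → Set
Position G k = Fin (E G) → Maybe (Fin k)

Complete : (G : Graph) {k : ℕ} → Position G k → Set
Complete G p = ∀ e → ¬ (p e ≡ nothing)

Legal : (G : Graph) {k : ℕ} → Position G k → Fin (E G) → Fin k → Set
Legal G p e c =
  (p e ≡ nothing) × (∀ f → Adjacent G e f → ¬ (p f ≡ just c))

open import Data.Fin using (_≟_)
open import Relation.Nullary using (yes; no)

update : (G : Graph) {k : ℕ} → Position G k → Fin (E G) → Fin k → Position G k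
update G p e c f with f ≟ e
... | yes _ = just c
... | no  _ = p f

SomeMove : (G : Graph) {k : ℕ} → Position G k → Set
SomeMove G {k} p = ∃[ e ] ∃[ c ] Legal G {k} p e c

-- The game ends when no legal move exists; Alice wins iff all edges coloured. The game is finite (Bob must colour an edge each
-- turn while moves exist), so these inductive predicates express exactly the
-- existence of a winning strategy for Alice.
data BobToMoveWin (G : Graph) {k : ℕ} (p : Position G k) : Set
data AliceToMoveWin (G : Graph) {k : ℕ} (p : Position G k) : Set

data BobToMoveWin G {k} p where
  bDone : Complete G p → BobToMoveWin G p
  bStep : SomeMove G p →
          (∀ e c → Legal G p e c → AliceToMoveWin G (update G p e c)) →
          BobToMoveWin G p

data AliceToMoveWin G {k} p where
  aDone : Complete G p → AliceToMoveWin G p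
  aMove : ∀ e c → Legal G p e c → BobToMoveWin G (update G p e c) →
          AliceToMoveWin G p
  aSkip : SomeMove G p → BobToMoveWin G p → AliceToMoveWin G p

emptyPos : (G : Graph) (k : ℕ) → Position G k
emptyPos G k _ = nothing

AliceWinsBA : Graph → ℕ → Set
AliceWinsBA G k = BobToMoveWin G {k} (emptyPos G k)

LineBANice : Graph → Set
LineBANice G =
  ∃[ ω ] (IsOmegaL G ω × AliceWinsBA G ω × (∀ k → k < ω → ¬ AliceWinsBA G k))

-- Diamond of n flowers.
-- Vertices (Fin (4 + n)): v = 0, u₁ = 1, u₂ = 2, w = 3, x_j = 4 + (j-1).
-- Edges (Fin (5 + n)): vu₁, vu₂, u₁u₂, wu₁, wu₂, then vx_j.

diamondEnds : (n : ℕ) → Fin (5 + n) → Fin (4 + n) × Fin (4 + n)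
diamondEnds n zero = (zero , suc zero)
diamondEnds n (suc zero) = (zero , suc (suc zero))
diamondEnds n (suc (suc zero)) = (suc zero , suc (suc zero))
diamondEnds n (suc (suc (suc zero))) = (suc (suc (suc zero)) , suc zero)
diamondEnds n (suc (suc (suc (suc zero)))) = (suc (suc (suc zero)) , suc (suc zero))
diamondEnds n (suc (suc (suc (suc (suc j))))) = (zero , suc (suc (suc (suc j))))

diamond : ℕ → Graph
diamond n = record { V = 4 + n ; E = 5 + n ; ends = diamondEnds n }

-- The n + 2 edges at v pairwise meet, while the proper colouring with classes {vu₁, wu₂}, {vu₂, wu₁},
-- {u₁u₂, vx₁} and {vx_j} for j ≥ 2 shows that no n + 3 edges do; hence ω(L) = n + 2. With fewer colours
-- every position of the game is a proper partial colouring, which can never colour the whole star at v.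
-- With n + 2 ≥ 5 colours Alice spends her first two moves colouring vu₁ and vu₂ with colours not used
-- so far; after that every uncoloured edge has at most max(4, n + 1) < n + 2 neighbours, so no player
-- can get stuck before the end. For n = 1, 2 Alice's win is certified by a search of the game tree.

module Submission where

open import Defs
open import Data.Nat using (ℕ; zero; suc; _+_; _≤_; _<_; z≤n; s≤s)
open import Data.Nat.Properties
  using (<⇒≤; <⇒≱; ≤-refl; ≤-<-trans; m≤n⇒m≤1+n; +-suc; m+n≡0⇒m≡0; m+n≡0⇒n≡0; suc-injective)
open import Data.Bool using (Bool; false; _∧_; _∨_; not; T)
open import Data.Bool.Properties using (T-∧; T-∨)
open import Data.Fin using (Fin; zero; suc; _≟_; punchIn; punchOut)
open import Data.Fin.Properties using (all?; any?; injective⇒≤; punchIn-punchOut)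
import Data.Fin.Properties as Fin
open import Data.Fin.Permutation using (Permutation′; _⟨$⟩ʳ_; _⟨$⟩ˡ_; inverseˡ; inverseʳ; flip; transpose)
open import Data.Maybe using (Maybe; just; nothing)
import Data.Maybe as Maybe
open import Data.Maybe.Properties using (just-injective; ≡-dec)
open import Data.Product using (_×_; _,_; proj₁; proj₂; ∃; ∃-syntax)
open import Data.Sum using (_⊎_; inj₁; inj₂)
open import Data.Empty using (⊥-elim)
open import Data.Unit using (tt)
open import Data.List using (List; []; _∷_; length; lookup; map; allFin)
open import Data.List.Properties using (length-map; length-tabulate)
open import Data.List.Membership.Propositional using (_∈_; _∉_)
open import Data.List.Membership.Propositional.Properties using (∈-map⁺; ∈-map⁻; ∈-lookup; ∈-allFin)
open import Data.List.Relation.Unary.All as All using ()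
open import Data.List.Relation.Unary.AllPairs using (_∷_)
import Data.List.Relation.Unary.Any as Any
open import Data.List.Relation.Unary.Any.Properties using (lookup-index)
open import Data.List.Relation.Unary.Unique.Propositional using (Unique)
open import Data.List.Relation.Unary.Unique.Propositional.Properties using (map⁺; allFin⁺)
open import Function using (_∘_; Injective)
open import Function.Bundles using (Equivalence)
open import Relation.Nullary using (¬_; Dec; yes; no; ¬?; contradiction)
open import Relation.Nullary.Decidable
  using (⌊_⌋; True; toWitness; fromWitness; decidable-stable; dec-true; dec-false; map′; T?; _×-dec_; _⊎-dec_; _→-dec_)
open import Relation.Binary.PropositionalEquality
  using (_≡_; _≢_; refl; sym; trans; cong; cong₂; subst; module ≡-Reasoning)

open Equivalence using (to)

_≟ᴹ_ : ∀ {k} (a b : Maybe (Fin k)) → Dec (a ≡ b)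
_≟ᴹ_ = ≡-dec _≟_

fresh-colour : ∀ {k} (xs : List (Maybe (Fin k))) → length xs < k → ∃[ c ] just c ∉ xs
fresh-colour {k} xs short with any? (λ c → ¬? (Any.any? (just c ≟ᴹ_) xs))
... | yes fresh = fresh
... | no  none  = contradiction (injective⇒≤ position-injective) (<⇒≱ short)
  where
  occurs : ∀ c → just c ∈ xs
  occurs c = decidable-stable (Any.any? (just c ≟ᴹ_) xs) (λ c∉xs → none (c , c∉xs))

  position : Fin k → Fin (length xs)
  position c = Any.index (occurs c)

  position-injective : Injective _≡_ _≡_ position
  position-injective {c} {d} same = just-injective (begin
    just c                 ≡⟨ lookup-index (occurs c) ⟩
    lookup xs (position c) ≡⟨ cong (lookup xs) same ⟩
    lookup xs (position d) ≡⟨ lookup-index (occurs d) ⟨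
    just d                 ∎)
    where open ≡-Reasoning

fresh-colour-outside : ∀ {k} (cs : List (Fin k)) → length cs < k → ∃[ c ] c ∉ cs
fresh-colour-outside cs short
  with c , just-c∉ ← fresh-colour (map just cs) (subst (_< _) (sym (length-map just cs)) short)
  = c , just-c∉ ∘ ∈-map⁺ just

module _ {G : Graph} {k : ℕ} {p : Position G k} {e : Fin (E G)} {c : Fin k} where

  update-≡ : update G p e c e ≡ just c
  update-≡ with e ≟ e
  ... | yes _   = refl
  ... | no  e≢e = contradiction refl e≢e

  update-≢ : ∀ {f} → f ≢ e → update G p e c f ≡ p f
  update-≢ {f} f≢e with f ≟ e
  ... | yes f≡e = contradiction f≡e f≢e
  ... | no  _   = refl

update-coloured : ∀ {G k} (p : Position G k) e c {f} → p f ≢ nothing → update G p e c f ≢ nothing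
update-coloured p e c {f} pf≢nothing with f ≟ e
... | yes _ = λ ()
... | no  _ = pf≢nothing

adjacent-sym : ∀ {G e f} → Adjacent G e f → Adjacent G f e
adjacent-sym (e≢f , x , e∋x , f∋x) = e≢f ∘ sym , x , f∋x , e∋x

adjacent? : ∀ (G : Graph) e f → Dec (Adjacent G e f)
adjacent? G e f = ¬? (e ≟ f) ×-dec map′ common-end meeting-ends
  (((a ≟ c) ⊎-dec (a ≟ d)) ⊎-dec ((b ≟ c) ⊎-dec (b ≟ d)))
  where
  a = proj₁ (ends G e)
  b = proj₂ (ends G e)
  c = proj₁ (ends G f)
  d = proj₂ (ends G f)

  common-end : (a ≡ c ⊎ a ≡ d) ⊎ (b ≡ c ⊎ b ≡ d) → ∃[ x ] ((G incident e) x × (G incident f) x)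
  common-end (inj₁ (inj₁ a≡c)) = c , inj₁ a≡c , inj₁ refl
  common-end (inj₁ (inj₂ a≡d)) = d , inj₁ a≡d , inj₂ refl
  common-end (inj₂ (inj₁ b≡c)) = c , inj₂ b≡c , inj₁ refl
  common-end (inj₂ (inj₂ b≡d)) = d , inj₂ b≡d , inj₂ refl

  meeting-ends : ∃[ x ] ((G incident e) x × (G incident f) x) → (a ≡ c ⊎ a ≡ d) ⊎ (b ≡ c ⊎ b ≡ d)
  meeting-ends (_ , inj₁ a≡x , inj₁ c≡x) = inj₁ (inj₁ (trans a≡x (sym c≡x)))
  meeting-ends (_ , inj₁ a≡x , inj₂ d≡x) = inj₁ (inj₂ (trans a≡x (sym d≡x)))
  meeting-ends (_ , inj₂ b≡x , inj₁ c≡x) = inj₂ (inj₁ (trans b≡x (sym c≡x)))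
  meeting-ends (_ , inj₂ b≡x , inj₂ d≡x) = inj₂ (inj₂ (trans b≡x (sym d≡x)))

coloured : ∀ {G k} {p : Position G k} → Complete G p → ∀ e → ∃[ c ] p e ≡ just c
coloured {p = p} complete e with p e in pe
... | just c  = c , refl
... | nothing = contradiction pe (complete e)

Unused : ∀ (G : Graph) {k} → Position G k → Fin k → Set
Unused G p c = ∀ f → p f ≢ just c

Palette : ∀ (G : Graph) {k} → Position G k → List (Fin k) → Set
Palette G p cs = ∀ f c → p f ≡ just c → c ∈ cs

module _ {G : Graph} {k : ℕ} {p : Position G k} where

  palette-update : ∀ {e c cs} → Palette G p cs → Palette G (update G p e c) (c ∷ cs)
  palette-update {e} palette f c′ p′f≡c′ with f ≟ e
  ... | yes _ = Any.here (just-injective (sym p′f≡c′))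
  ... | no  _ = Any.there (palette f c′ p′f≡c′)

  legal-outside-palette : ∀ {cs e c} → Palette G p cs → c ∉ cs → p e ≡ nothing → Legal G p e c
  legal-outside-palette palette c∉cs pe = pe , λ f _ → c∉cs ∘ palette f _

  legal-in-neighbourhood : ∀ {e} (ns : List (Fin (E G))) → (∀ {f} → Adjacent G e f → f ∈ ns) →
                           length ns < k → p e ≡ nothing → ∃[ c ] Legal G p e c
  legal-in-neighbourhood ns covers short pe
    with c , just-c∉ ← fresh-colour (map p ns) (subst (_< _) (sym (length-map p ns)) short)
    = c , pe , λ f adj pf≡c → just-c∉ (subst (_∈ map p ns) pf≡c (∈-map⁺ p (covers adj)))

-- Greedy play

hole : ∀ {A : Set} → Maybe A → ℕ
hole nothing  = 1
hole (just _) = 0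

holes : ∀ {m} {A : Set} → (Fin m → Maybe A) → ℕ
holes {zero}  q = 0
holes {suc m} q = hole (q zero) + holes (q ∘ suc)

module _ {A : Set} where

  holes-cong : ∀ {m} {q r : Fin m → Maybe A} → (∀ i → q i ≡ r i) → holes q ≡ holes r
  holes-cong {zero}  _   = refl
  holes-cong {suc m} q≗r = cong₂ _+_ (cong hole (q≗r zero)) (holes-cong (q≗r ∘ suc))

  holes-fill : ∀ {m} {q r : Fin m → Maybe A} {e a} → q e ≡ nothing → r e ≡ just a →
               (∀ f → f ≢ e → r f ≡ q f) → holes q ≡ suc (holes r)
  holes-fill {suc m} {q} {r} {zero} qe re elsewhere rewrite qe | re =
    cong suc (holes-cong λ f → sym (elsewhere (suc f) λ ()))
  holes-fill {suc m} {q} {r} {suc e} qe re elsewhere rewrite elsewhere zero (λ ()) =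
    trans (cong (hole (q zero) +_) (holes-fill qe re λ f f≢e → elsewhere (suc f) (f≢e ∘ Fin.suc-injective)))
          (+-suc (hole (q zero)) _)

  no-holes : ∀ {m} (q : Fin m → Maybe A) → holes q ≡ 0 → ∀ i → q i ≢ nothing
  no-holes q none zero    q0≡nothing = contradiction (trans (cong hole (sym q0≡nothing)) (m+n≡0⇒m≡0 _ none)) λ ()
  no-holes q none (suc i) = no-holes (q ∘ suc) (m+n≡0⇒n≡0 (hole (q zero)) none) i

holes-update : ∀ (G : Graph) {k} {p : Position G k} {e c t} → Legal G p e c → holes p ≡ suc t →
               holes (update G p e c) ≡ t
holes-update G {p = p} {e} {c} (pe , _) holes-p =
  suc-injective (trans (sym (holes-fill pe (update-≡ {p = p} {e} {c}) λ _ → update-≢ {p = p} {e} {c})) holes-p)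

module Greedy (G : Graph) {k : ℕ} (Safe : Position G k → Set)
              (safe-update : ∀ {p} e c → Safe p → Safe (update G p e c))
              (safe-colourable : ∀ {p e} → Safe p → p e ≡ nothing → ∃[ c ] Legal G p e c) where

  bob-wins-within : ∀ t {p} → holes p ≡ t → Safe p → BobToMoveWin G p
  alice-wins-within : ∀ t {p} → holes p ≡ t → Safe p → AliceToMoveWin G p

  bob-wins-within zero {p} none _ = bDone (no-holes p none)
  bob-wins-within (suc t) {p} holes-p safe with any? (λ e → p e ≟ᴹ nothing)
  ... | no  full         = bDone λ e pe → full (e , pe)
  ... | yes (e , pe) = bStep (e , safe-colourable safe pe) λ e′ c′ legal →
    alice-wins-within t (holes-update G legal holes-p) (safe-update e′ c′ safe)

  alice-wins-within zero {p} none _ = aDone (no-holes p none)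
  alice-wins-within (suc t) {p} holes-p safe with any? (λ e → p e ≟ᴹ nothing)
  ... | no  full     = aDone λ e pe → full (e , pe)
  ... | yes (e , pe) with c , legal ← safe-colourable safe pe =
    aMove e c legal (bob-wins-within t (holes-update G legal holes-p) (safe-update e c safe))

  bob-wins : ∀ {p} → Safe p → BobToMoveWin G p
  bob-wins = bob-wins-within _ refl

  alice-wins : ∀ {p} → Safe p → AliceToMoveWin G p
  alice-wins = alice-wins-within _ refl

-- Too few colours

lookup-injective : ∀ {A : Set} {xs : List A} → Unique xs → ∀ {i j} → lookup xs i ≡ lookup xs j → i ≡ j
lookup-injective (_   ∷ _)      {zero}  {zero}  _    = refl
lookup-injective (x∉xs ∷ _)     {zero}  {suc j} same = contradiction same (All.lookup x∉xs (∈-lookup j))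
lookup-injective (x∉xs ∷ _)     {suc i} {zero}  same = contradiction (sym same) (All.lookup x∉xs (∈-lookup i))
lookup-injective (_   ∷ unique) {suc i} {suc j} same = cong suc (lookup-injective unique same)

clique-bounded-by-colouring : ∀ {G k S} (χ : Fin (E G) → Fin k) → (∀ {e f} → Adjacent G e f → χ e ≢ χ f) →
                              IsEdgeClique G S → length S ≤ k
clique-bounded-by-colouring {S = S} χ proper (unique , clique) = injective⇒≤ colour-injective
  where
  colour-injective : Injective _≡_ _≡_ (χ ∘ lookup S)
  colour-injective {i} {j} same with i ≟ j
  ... | yes i≡j = i≡j
  ... | no  i≢j = contradiction same (proper (clique (∈-lookup i) (∈-lookup j) (i≢j ∘ lookup-injective unique)))

Proper : ∀ (G : Graph) {k} → Position G k → Set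
Proper G p = ∀ {e f c} → Adjacent G e f → p e ≡ just c → p f ≢ just c

proper-update : ∀ {G k} {p : Position G k} {e c} → Proper G p → Legal G p e c → Proper G (update G p e c)
proper-update {e = e} proper (_ , avoids) {e₁} {f₁} adj e₁↦c₁ f₁↦c₁ with e₁ ≟ e | f₁ ≟ e
... | yes refl | yes refl = proj₁ adj refl
... | yes refl | no _    = avoids f₁ adj (trans f₁↦c₁ (sym e₁↦c₁))
... | no _    | yes refl = avoids e₁ (adjacent-sym adj) (trans e₁↦c₁ (sym f₁↦c₁))
... | no _    | no _     = proper adj e₁↦c₁ f₁↦c₁

module _ {G : Graph} {k : ℕ} {S : List (Fin (E G))} (clique : IsEdgeClique G S) (few : k < length S) where

  proper-incomplete : ∀ {p : Position G k} → Proper G p → ¬ Complete G p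
  proper-incomplete proper complete = <⇒≱ few (clique-bounded-by-colouring χ χ-proper clique)
    where
    χ : Fin (E G) → Fin k
    χ = proj₁ ∘ coloured {G} complete

    χ-proper : ∀ {e f} → Adjacent G e f → χ e ≢ χ f
    χ-proper {e} {f} adj same =
      proper adj (proj₂ (coloured {G} complete e)) (trans (proj₂ (coloured {G} complete f)) (cong just (sym same)))

  bob-loses : ∀ {p : Position G k} → Proper G p → ¬ BobToMoveWin G p
  alice-loses : ∀ {p : Position G k} → Proper G p → ¬ AliceToMoveWin G p
  bob-loses proper (bDone complete)                = proper-incomplete proper complete
  bob-loses proper (bStep (e , c , legal) replies) = alice-loses (proper-update proper legal) (replies e c legal)
  alice-loses proper (aDone complete)      = proper-incomplete proper complete
  alice-loses proper (aMove _ _ legal win) = bob-loses (proper-update proper legal) win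
  alice-loses proper (aSkip _ win)         = bob-loses proper win

alice-loses-below-ω : ∀ {G ω k} → IsOmegaL G ω → k < ω → ¬ AliceWinsBA G k
alice-loses-below-ω ((S , clique , refl) , _) few = bob-loses clique few λ _ ()

-- Renaming colours

record Recoloured (G : Graph) {k} (π : Permutation′ k) (p q : Position G k) : Set where
  constructor recoloured
  field at : ∀ f → q f ≡ Maybe.map (π ⟨$⟩ʳ_) (p f)
open Recoloured

module _ {G : Graph} {k : ℕ} where

  recoloured-flip : ∀ {π} {p q : Position G k} → Recoloured G π p q → Recoloured G (flip π) q p
  recoloured-flip {π} {p} r = recoloured λ f → flipped f (at r f)
    where
    flipped : ∀ f {m} → m ≡ Maybe.map (π ⟨$⟩ʳ_) (p f) → p f ≡ Maybe.map (π ⟨$⟩ˡ_) m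
    flipped f refl with p f
    ... | nothing = refl
    ... | just c  = cong just (sym (inverseˡ π))

  complete-recoloured : ∀ {π} {p q : Position G k} → Recoloured G π p q → Complete G p → Complete G q
  complete-recoloured r complete f qf = complete f (trans (at (recoloured-flip r) f) (cong (Maybe.map _) qf))

  legal-recoloured : ∀ {π} {p q : Position G k} {e c} → Recoloured G π p q → Legal G p e c → Legal G q e (π ⟨$⟩ʳ c)
  legal-recoloured {π} r (pe , avoids) = trans (at r _) (cong (Maybe.map _) pe) , λ f adj qf →
    avoids f adj (trans (at (recoloured-flip r) f) (trans (cong (Maybe.map _) qf) (cong just (inverseˡ π))))

  update-recoloured : ∀ {π} {p q : Position G k} {e c c′} → Recoloured G π p q → c′ ≡ π ⟨$⟩ʳ c →
                      Recoloured G π (update G p e c) (update G q e c′)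
  update-recoloured {π} {p} {q} {e} {c} {c′} r c′≡πc = recoloured updated
    where
    updated : ∀ f → update G q e c′ f ≡ Maybe.map (π ⟨$⟩ʳ_) (update G p e c f)
    updated f with f ≟ e
    ... | yes _ = cong just c′≡πc
    ... | no  _ = at r f

  bob-wins-recoloured : ∀ π {p q : Position G k} → Recoloured G π p q → BobToMoveWin G p → BobToMoveWin G q
  alice-wins-recoloured : ∀ π {p q : Position G k} → Recoloured G π p q → AliceToMoveWin G p → AliceToMoveWin G q
  bob-wins-recoloured π r (bDone complete) = bDone (complete-recoloured r complete)
  bob-wins-recoloured π r (bStep (e , c , legal) replies) =
    bStep (e , _ , legal-recoloured r legal) λ e′ c′ legal′ →
      alice-wins-recoloured π (update-recoloured r (sym (inverseʳ π)))
        (replies e′ _ (legal-recoloured (recoloured-flip r) legal′))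
  alice-wins-recoloured π r (aDone complete) = aDone (complete-recoloured r complete)
  alice-wins-recoloured π r (aMove e c legal win) =
    aMove e _ (legal-recoloured r legal) (bob-wins-recoloured π (update-recoloured r refl) win)
  alice-wins-recoloured π r (aSkip (e , c , legal) win) =
    aSkip (e , _ , legal-recoloured r legal) (bob-wins-recoloured π r win)

transpose-sends : ∀ {k} (i j : Fin k) → transpose i j ⟨$⟩ʳ i ≡ j
transpose-sends i j rewrite dec-true (i ≟ i) refl = refl

transpose-fixes : ∀ {k} {i j x : Fin k} → x ≢ i → x ≢ j → transpose i j ⟨$⟩ʳ x ≡ x
transpose-fixes {i = i} {j} {x} x≢i x≢j rewrite dec-false (x ≟ i) x≢i | dec-false (x ≟ j) x≢j = refl

unused-swap : ∀ {G k} {p : Position G k} {c d} → Unused G p c → Unused G p d → Recoloured G (transpose c d) p p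
unused-swap {p = p} unused-c unused-d = recoloured fixed
  where
  fixed : ∀ f → p f ≡ Maybe.map (transpose _ _ ⟨$⟩ʳ_) (p f)
  fixed f with p f in pf
  ... | nothing = refl
  ... | just x  = cong just (sym (transpose-fixes (unused-c f ∘ trans pf ∘ cong just) (unused-d f ∘ trans pf ∘ cong just)))

-- Verified game-tree search

module GameSearch (G : Graph) (k : ℕ) (reply : Fin (E G) → Fin (E G)) where

  legal? : ∀ (p : Position G k) e c → Dec (Legal G p e c)
  legal? p e c = (p e ≟ᴹ nothing) ×-dec all? λ f → adjacent? G e f →-dec ¬? (p f ≟ᴹ just c)

  complete? : ∀ (p : Position G k) → Dec (Complete G p)
  complete? p = all? λ e → ¬? (p e ≟ᴹ nothing)

  some-move? : ∀ (p : Position G k) → Dec (SomeMove G p)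
  some-move? p = any? λ e → any? λ c → legal? p e c

  unused? : ∀ (p : Position G k) c → Dec (Unused G p c)
  unused? p c = all? λ f → ¬? (p f ≟ᴹ just c)

  -- Up to swapping two colours unused in p, Bob's move with one of them is his move with the other,
  -- so moves with an unused colour other than the one `any?` finds need not be searched.
  redundant : ∀ (p : Position G k) → Dec (∃ (Unused G p)) → Fin k → Bool
  redundant p (yes (d , _)) c = not ⌊ c ≟ d ⌋ ∧ ⌊ unused? p c ⌋
  redundant p (no _)        c = false

  bob-search : ℕ → Position G k → Bool
  alice-search : ℕ → Position G k → Fin (E G) → Fin k → Bool
  bob-replies? : ∀ t p (fresh : Dec (∃ (Unused G p))) →
    Dec (∀ e c → Legal G p e c → T (redundant p fresh c ∨ alice-search t (update G p e c) e c))
  alice-fallback? : ∀ t p → Dec (∃[ c ] ∃[ e ] (Legal G p e c × T (bob-search t (update G p e c))))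

  bob-search zero    p = false
  bob-search (suc t) p = ⌊ complete? p ⌋ ∨ (⌊ some-move? p ⌋ ∧ ⌊ bob-replies? t p (any? (unused? p)) ⌋)

  bob-replies? t p fresh = all? λ e → all? λ c →
    legal? p e c →-dec T? (redundant p fresh c ∨ alice-search t (update G p e c) e c)

  -- `reply` only guides the search: Alice first tries to answer Bob's move on e by colouring
  -- `reply e` with the same colour.
  alice-search zero    p e c = false
  alice-search (suc t) p e c =
    ⌊ complete? p ⌋ ∨
    (⌊ legal? p (reply e) c ⌋ ∧ bob-search t (update G p (reply e) c)) ∨
    ⌊ alice-fallback? t p ⌋

  alice-fallback? t p = any? λ c → any? λ e → legal? p e c ×-dec T? (bob-search t (update G p e c))

  redundant-self : ∀ (p : Position G k) {d} (unused-d : Unused G p d) → redundant p (yes (d , unused-d)) d ≡ false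
  redundant-self p {d} _ with d ≟ d
  ... | yes _   = refl
  ... | no  d≢d = contradiction refl d≢d

  bob-search-sound : ∀ t p → T (bob-search t p) → BobToMoveWin G p
  bob-replies-sound : ∀ t p fresh →
    (∀ e c → Legal G p e c → T (redundant p fresh c ∨ alice-search t (update G p e c) e c)) →
    ∀ e c → Legal G p e c → AliceToMoveWin G (update G p e c)
  alice-search-sound : ∀ t p e c → T (alice-search t p e c) → AliceToMoveWin G p

  bob-search-sound (suc t) p found with to T-∨ found
  ... | inj₁ complete = bDone (toWitness {a? = complete? p} complete)
  ... | inj₂ step with move , replies ← to T-∧ step =
    bStep (toWitness {a? = some-move? p} move)
      (bob-replies-sound t p fresh (toWitness {a? = bob-replies? t p fresh} replies))
    where fresh = any? (unused? p)

  bob-replies-sound t p fresh found e c legal with to T-∨ (found e c legal)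
  ... | inj₂ won = alice-search-sound t _ e c won
  bob-replies-sound t p (no _) found e c legal | inj₁ ()
  bob-replies-sound t p (yes (d , unused-d)) found e c (pe , _) | inj₁ skipped
    with _ , unused-c ← to (T-∧ {not ⌊ c ≟ d ⌋}) skipped =
    alice-wins-recoloured (transpose d c)
      (update-recoloured (unused-swap unused-d (toWitness unused-c)) (sym (transpose-sends d c)))
      (alice-search-sound t _ e d won-with-d)
    where
    won-with-d : T (alice-search t (update G p e d) e d)
    won-with-d = subst (λ b → T (b ∨ alice-search t (update G p e d) e d)) (redundant-self p unused-d)
                   (found e d (pe , λ f _ → unused-d f))

  alice-search-sound (suc t) p e c found with to T-∨ found
  ... | inj₁ complete = aDone (toWitness {a? = complete? p} complete)
  ... | inj₂ rest with to T-∨ rest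
  ...   | inj₁ answered with legal , won ← to T-∧ answered =
    aMove (reply e) c (toWitness {a? = legal? p (reply e) c} legal) (bob-search-sound t _ won)
  ...   | inj₂ other with c′ , e′ , legal , won ← toWitness {a? = alice-fallback? t p} other =
    aMove e′ c′ legal (bob-search-sound t _ won)

  alice-wins-by-search : T (bob-search (suc (E G)) (emptyPos G k)) → AliceWinsBA G k
  alice-wins-by-search = bob-search-sound (suc (E G)) (emptyPos G k)

-- The diamond of flowers

-- `vx j` is the edge v x_(j+1).
pattern vu₁  = zero
pattern vu₂  = suc zero
pattern u₁u₂ = suc (suc zero)
pattern wu₁  = suc (suc (suc zero))
pattern wu₂  = suc (suc (suc (suc zero)))
pattern vx j = suc (suc (suc (suc (suc j))))

-- For two non-adjacent edges of a diamond the decision computes to `no`, so the result type is ⊥.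
adjacency-check : ∀ {n} {e f : Fin (5 + n)} → Adjacent (diamond n) e f → True (adjacent? (diamond n) e f)
adjacency-check = fromWitness

spoke : ∀ {n} → Fin (2 + n) → Fin (5 + n)
spoke zero          = vu₁
spoke (suc zero)    = vu₂
spoke (suc (suc j)) = vx j

spoke-injective : ∀ {n} → Injective _≡_ _≡_ (spoke {n})
spoke-injective {x = zero}          {zero}          _    = refl
spoke-injective {x = suc zero}      {suc zero}      _    = refl
spoke-injective {x = suc (suc i)}   {suc (suc j)}   refl = refl
spoke-injective {x = zero}          {suc zero}      ()
spoke-injective {x = zero}          {suc (suc _)}   ()
spoke-injective {x = suc zero}      {zero}          ()
spoke-injective {x = suc zero}      {suc (suc _)}   ()
spoke-injective {x = suc (suc _)}   {zero}          ()
spoke-injective {x = suc (suc _)}   {suc zero}      ()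

spoke-at-v : ∀ {n} (s : Fin (2 + n)) → proj₁ (diamondEnds n (spoke s)) ≡ zero
spoke-at-v zero          = refl
spoke-at-v (suc zero)    = refl
spoke-at-v (suc (suc _)) = refl

spokes-adjacent : ∀ {n} {s t : Fin (2 + n)} → s ≢ t → Adjacent (diamond n) (spoke s) (spoke t)
spokes-adjacent {s = s} {t} s≢t = s≢t ∘ spoke-injective , zero , inj₁ (spoke-at-v s) , inj₁ (spoke-at-v t)

star : ∀ n → List (Fin (5 + n))
star n = map spoke (allFin (2 + n))

star-clique : ∀ n → IsEdgeClique (diamond n) (star n)
star-clique n = map⁺ spoke-injective (allFin⁺ _) , λ e∈ f∈ e≢f → spokes-of (∈-map⁻ spoke e∈) (∈-map⁻ spoke f∈) e≢f
  where
  spokes-of : ∀ {e f} → ∃[ s ] (s ∈ allFin (2 + n) × e ≡ spoke s) → ∃[ t ] (t ∈ allFin (2 + n) × f ≡ spoke t) →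
              e ≢ f → Adjacent (diamond n) e f
  spokes-of (s , _ , refl) (t , _ , refl) e≢f = spokes-adjacent (e≢f ∘ cong spoke)

star-length : ∀ n → length (star n) ≡ 2 + n
star-length n = trans (length-map spoke (allFin (2 + n))) (length-tabulate (λ s → s))

colour-class : ∀ {n} → Fin (5 + suc n) → Fin (3 + n)
colour-class vu₁    = zero
colour-class wu₂    = zero
colour-class vu₂    = suc zero
colour-class wu₁    = suc zero
colour-class u₁u₂   = suc (suc zero)
colour-class (vx j) = suc (suc j)

class-members : ∀ {n} → Fin (3 + n) → Fin (5 + suc n) × Fin (5 + suc n)
class-members zero                = vu₁ , wu₂
class-members (suc zero)          = vu₂ , wu₁
class-members (suc (suc zero))    = u₁u₂ , vx zero
class-members (suc (suc (suc j))) = vx (suc j) , vx (suc j)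

InClass : ∀ {n} → Fin (3 + n) → Fin (5 + suc n) → Set
InClass s e = e ≡ proj₁ (class-members s) ⊎ e ≡ proj₂ (class-members s)

in-colour-class : ∀ {n} (e : Fin (5 + suc n)) → InClass (colour-class e) e
in-colour-class vu₁          = inj₁ refl
in-colour-class wu₂          = inj₂ refl
in-colour-class vu₂          = inj₁ refl
in-colour-class wu₁          = inj₂ refl
in-colour-class u₁u₂         = inj₁ refl
in-colour-class (vx zero)    = inj₂ refl
in-colour-class (vx (suc j)) = inj₁ refl

class-members-independent : ∀ {n} (s : Fin (3 + n)) →
                            ¬ Adjacent (diamond (suc n)) (proj₁ (class-members s)) (proj₂ (class-members s))
class-members-independent zero                adj       = adjacency-check adj
class-members-independent (suc zero)          adj       = adjacency-check adj
class-members-independent (suc (suc zero))    adj       = adjacency-check adj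
class-members-independent (suc (suc (suc _))) (e≢e , _) = e≢e refl

colour-class-proper : ∀ {n} {e f : Fin (5 + suc n)} → Adjacent (diamond (suc n)) e f →
                      colour-class e ≢ colour-class f
colour-class-proper {n} {e} {f} adj same =
  independent {colour-class e} (in-colour-class e) (subst (λ s → InClass s f) (sym same) (in-colour-class f)) adj
  where
  independent : ∀ {s e f} → InClass s e → InClass s f → ¬ Adjacent (diamond (suc n)) e f
  independent {s} (inj₁ refl) (inj₂ refl) adj       = class-members-independent s adj
  independent {s} (inj₂ refl) (inj₁ refl) adj       = class-members-independent s (adjacent-sym {diamond (suc n)} adj)
  independent     (inj₁ refl) (inj₁ refl) (e≢e , _) = e≢e refl
  independent     (inj₂ refl) (inj₂ refl) (e≢e , _) = e≢e refl

diamond-ω : ∀ n → IsOmegaL (diamond (suc n)) (3 + n)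
diamond-ω n = (star (suc n) , star-clique (suc n) , star-length (suc n)) ,
              λ _ → clique-bounded-by-colouring colour-class colour-class-proper

module _ {n : ℕ} where

  other-spokes : Fin (2 + n) → List (Fin (5 + n))
  other-spokes s = map (spoke ∘ punchIn s) (allFin (suc n))

  other-spokes-length : ∀ s → length (other-spokes s) ≡ suc n
  other-spokes-length s = trans (length-map _ (allFin (suc n))) (length-tabulate (λ t → t))

  ∈-other-spokes : ∀ {s t} → t ≢ s → spoke t ∈ other-spokes s
  ∈-other-spokes {s} t≢s = subst (_∈ other-spokes s) (cong spoke (punchIn-punchOut (t≢s ∘ sym)))
                                 (∈-map⁺ (spoke ∘ punchIn s) (∈-allFin (punchOut (t≢s ∘ sym))))

  u₁u₂-neighbours : ∀ {f} → Adjacent (diamond n) u₁u₂ f → f ∈ vu₁ ∷ vu₂ ∷ wu₁ ∷ wu₂ ∷ []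
  u₁u₂-neighbours {vu₁}  _         = Any.here refl
  u₁u₂-neighbours {vu₂}  _         = Any.there (Any.here refl)
  u₁u₂-neighbours {u₁u₂} (e≢e , _) = contradiction refl e≢e
  u₁u₂-neighbours {wu₁}  _         = Any.there (Any.there (Any.here refl))
  u₁u₂-neighbours {wu₂}  _         = Any.there (Any.there (Any.there (Any.here refl)))
  u₁u₂-neighbours {vx _} adj       = ⊥-elim (adjacency-check adj)

  wu₁-neighbours : ∀ {f} → Adjacent (diamond n) wu₁ f → f ∈ vu₁ ∷ u₁u₂ ∷ wu₂ ∷ []
  wu₁-neighbours {vu₁}  _         = Any.here refl
  wu₁-neighbours {vu₂}  adj       = ⊥-elim (adjacency-check adj)
  wu₁-neighbours {u₁u₂} _         = Any.there (Any.here refl)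
  wu₁-neighbours {wu₁}  (e≢e , _) = contradiction refl e≢e
  wu₁-neighbours {wu₂}  _         = Any.there (Any.there (Any.here refl))
  wu₁-neighbours {vx _} adj       = ⊥-elim (adjacency-check adj)

  wu₂-neighbours : ∀ {f} → Adjacent (diamond n) wu₂ f → f ∈ vu₂ ∷ u₁u₂ ∷ wu₁ ∷ []
  wu₂-neighbours {vu₁}  adj       = ⊥-elim (adjacency-check adj)
  wu₂-neighbours {vu₂}  _         = Any.here refl
  wu₂-neighbours {u₁u₂} _         = Any.there (Any.here refl)
  wu₂-neighbours {wu₁}  _         = Any.there (Any.there (Any.here refl))
  wu₂-neighbours {wu₂}  (e≢e , _) = contradiction refl e≢e
  wu₂-neighbours {vx _} adj       = ⊥-elim (adjacency-check adj)

  vx-neighbours : ∀ {j f} → Adjacent (diamond n) (vx j) f → f ∈ other-spokes (suc (suc j))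
  vx-neighbours {f = vu₁}  _         = ∈-other-spokes {t = zero} λ ()
  vx-neighbours {f = vu₂}  _         = ∈-other-spokes {t = suc zero} λ ()
  vx-neighbours {f = u₁u₂} adj       = ⊥-elim (adjacency-check adj)
  vx-neighbours {f = wu₁}  adj       = ⊥-elim (adjacency-check adj)
  vx-neighbours {f = wu₂}  adj       = ⊥-elim (adjacency-check adj)
  vx-neighbours {f = vx i} (e≢f , _) = ∈-other-spokes {t = suc (suc i)} (e≢f ∘ cong spoke ∘ sym)

module LargeDiamond (n : ℕ) (3≤n : 3 ≤ n) where

  D : Graph
  D = diamond n

  K : ℕ
  K = 2 + n

  4<K : 4 < K
  4<K = s≤s (s≤s 3≤n)

  3<K : 3 < K
  3<K = <⇒≤ 4<K

  SpokesColoured : Position D K → Set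
  SpokesColoured p = p vu₁ ≢ nothing × p vu₂ ≢ nothing

  spokes-stay-coloured : ∀ {p} e c → SpokesColoured p → SpokesColoured (update D p e c)
  spokes-stay-coloured {p} e c (vu₁-coloured , vu₂-coloured) =
    update-coloured p e c vu₁-coloured , update-coloured p e c vu₂-coloured

  colourable : ∀ {p e} → SpokesColoured p → p e ≡ nothing → ∃[ c ] Legal D p e c
  colourable {e = vu₁}  (vu₁-coloured , _) pe = contradiction pe vu₁-coloured
  colourable {e = vu₂}  (_ , vu₂-coloured) pe = contradiction pe vu₂-coloured
  colourable {e = u₁u₂} _ = legal-in-neighbourhood _ u₁u₂-neighbours 4<K
  colourable {e = wu₁}  _ = legal-in-neighbourhood _ wu₁-neighbours 3<K
  colourable {e = wu₂}  _ = legal-in-neighbourhood _ wu₂-neighbours 3<K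
  colourable {e = vx j} _ =
    legal-in-neighbourhood _ vx-neighbours (subst (_< K) (sym (other-spokes-length (suc (suc j)))) ≤-refl)

  open Greedy D SpokesColoured spokes-stay-coloured colourable

  fresh : ∀ {cs : List (Fin K)} → length cs ≤ 3 → ∃[ c ] c ∉ cs
  fresh short = fresh-colour-outside _ (≤-<-trans short 3<K)

  colour-second-spoke : ∀ {p cs} → p vu₁ ≢ nothing → Palette D p cs → length cs ≤ 3 → AliceToMoveWin D p
  colour-second-spoke {p} vu₁-coloured palette short with p vu₂ ≟ᴹ nothing
  ... | no  vu₂-coloured = alice-wins (vu₁-coloured , vu₂-coloured)
  ... | yes vu₂-free with c , c∉cs ← fresh short =
    aMove vu₂ c (legal-outside-palette palette c∉cs vu₂-free)
      (bob-wins (update-coloured {D} p vu₂ c vu₁-coloured , λ ()))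

  bob-before-second-spoke : ∀ {p cs} → p vu₁ ≢ nothing → Palette D p cs → length cs ≤ 2 → BobToMoveWin D p
  bob-before-second-spoke {p} vu₁-coloured palette short with p vu₂ ≟ᴹ nothing
  ... | no  vu₂-coloured = bob-wins (vu₁-coloured , vu₂-coloured)
  ... | yes vu₂-free with c , c∉cs ← fresh (m≤n⇒m≤1+n short) =
    bStep (vu₂ , c , legal-outside-palette palette c∉cs vu₂-free) λ e c′ _ →
      colour-second-spoke (update-coloured {D} p e c′ vu₁-coloured) (palette-update palette) (s≤s short)

  colour-first-spoke : ∀ {p cs} → Palette D p cs → length cs ≤ 1 → AliceToMoveWin D p
  colour-first-spoke {p} palette short with p vu₁ ≟ᴹ nothing
  ... | no  vu₁-coloured = colour-second-spoke vu₁-coloured palette (m≤n⇒m≤1+n (m≤n⇒m≤1+n short))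
  ... | yes vu₁-free with c , c∉cs ← fresh (m≤n⇒m≤1+n (m≤n⇒m≤1+n short)) =
    aMove vu₁ c (legal-outside-palette palette c∉cs vu₁-free)
      (bob-before-second-spoke (λ ()) (palette-update palette) (s≤s short))

  alice-wins-large : AliceWinsBA D K
  alice-wins-large = bStep (vu₁ , zero , refl , λ _ _ ()) λ _ _ _ →
    colour-first-spoke (palette-update {cs = []} λ _ _ ()) ≤-refl

-- Partners within a colour class, except that flowers are answered on u₁u₂.
diamond-reply : ∀ {n} → Fin (5 + suc n) → Fin (5 + suc n)
diamond-reply vu₁    = wu₂
diamond-reply wu₂    = vu₁
diamond-reply vu₂    = wu₁
diamond-reply wu₁    = vu₂
diamond-reply u₁u₂   = vx zero
diamond-reply (vx _) = u₁u₂

alice-wins-diamond : ∀ n → AliceWinsBA (diamond (suc n)) (3 + n)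
alice-wins-diamond zero          = GameSearch.alice-wins-by-search (diamond 1) 3 diamond-reply tt
alice-wins-diamond (suc zero)    = GameSearch.alice-wins-by-search (diamond 2) 4 diamond-reply tt
alice-wins-diamond (suc (suc n)) = LargeDiamond.alice-wins-large (3 + n) (s≤s (s≤s (s≤s z≤n)))

lemma65 : (n : ℕ) → 1 ≤ n → LineBANice (diamond n)
lemma65 (suc n) _ = 3 + n , diamond-ω n , alice-wins-diamond n , λ _ → alice-loses-below-ω (diamond-ω n)
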